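{- For all integers $n\ge0$ and $k>1$, $$s_n(H_2^{k-1}UD)=\sum_{q=0}^{k-2}S_{n,q}+\sum_{p=0}^{2n-2k+2}\ \sum_{h=0}^{2n-p-2k+2}P_{p,h}\left(\!\!\binom{p+1}{k-2}\!\!\right)\left(\!\!\binom{\frac{2n-h-p-2k+4}{2}}{h}\!\!\right).$$
   Context: Schröder paths: - A Schröder path is a finite word over $\{U,D,H_2\}$, viewed as a lattice path from $(0,0)$ with steps $U=(1,1)$, $D=(1,-1)$, $H_2=(2,0)$, ending on the $x$-axis and never going below it. The empty path is allowed. - Its semilength is (number of $U$'s) + (number of $H_2$'s). Notation and avoidance: - $H_2^{k-1}UD$ is the word of $k-1$ letters $H_2$ followed by $UD$. - $Q$ avoids $P$ if $P$ is not a (not necessarily contiguous) subword of $Q$. - $s_n(P)$ is the number of Schröder paths of semilength $n$ avoiding $P$. Numbers appearing in the formula: - $S_{n,q}$ is the number of Schröder paths of semilength $n$ having exactly $q$ steps $H_2$; one has $S_{n,q}=\binom{2n-q}{q}C_{n-q}$, where $C_m=\frac{1}{m+1}\binom{2m}{m}$ is the Catalan number. - A Dyck prefix is a word over $\{U,D\}$ in which every prefix has at least as many $U$'s as $D$'s. Its height is (number of $U$'s) $-$ (number of $D$'s). - $P_{p,h}$ denotes the number of Dyck prefixes of length $p$ ending at height $h$; it is $0$ when $p$ and $h$ have different parity. - $\left(\!\binom{m}{i}\!\right)=\binom{m+i-1}{i}$ is the multiset coefficient, i.e. the number of multisets of size $i$ from an $m$-element set. -}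

module Defs where

open import Data.Nat using (ℕ; zero; suc; _+_; _*_; _∸_; _≟_)
open import Data.Nat.DivMod using (_/_)
open import Data.Nat.Combinatorics using (_C_)
open import Data.Nat.ListAction using (sum)
open import Data.Bool using (Bool; true; false; T; _∧_)
open import Data.Bool.Properties using (T?)
open import Data.List using (List; []; _∷_; length; filter; map; concatMap; upTo; replicate; _++_)
open import Data.Maybe using (Maybe; just; nothing)
open import Data.Product using (_×_; _,_)
open import Relation.Nullary using (¬_; Dec; yes; no)

open import Relation.Nullary.Decidable using (_×-dec_; ¬?)
open import Relation.Binary.PropositionalEquality using (_≡_; refl)
open import Relation.Binary.Definitions using (DecidableEquality)
import Data.Maybe.Properties as MaybeP

data Step : Set where
  U D H₂ : Step

_≟S_ : DecidableEquality Step
U  ≟S U  = yes refl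
U  ≟S D  = no λ ()
U  ≟S H₂ = no λ ()
D  ≟S U  = no λ ()
D  ≟S D  = yes refl
D  ≟S H₂ = no λ ()
H₂ ≟S U  = no λ ()
H₂ ≟S D  = no λ ()
H₂ ≟S H₂ = yes refl

open import Data.List.Relation.Binary.Sublist.DecPropositional _≟S_
  using (_⊆_; _⊆?_) public

wordsOfLength : {A : Set} → List A → ℕ → List (List A)
wordsOfLength alph zero    = [] ∷ []
wordsOfLength alph (suc L) =
  concatMap (λ a → map (a ∷_) (wordsOfLength alph L)) alph

allSteps : List Step
allSteps = U ∷ D ∷ H₂ ∷ []

wordsUpTo : ℕ → List (List Step)
wordsUpTo L = concatMap (wordsOfLength allSteps) (upTo (suc L))

validFrom : ℕ → List Step → Bool
validFrom zero    []        = true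
validFrom (suc h) []        = false
validFrom h       (U ∷ w)   = validFrom (suc h) w
validFrom zero    (D ∷ w)   = false
validFrom (suc h) (D ∷ w)   = validFrom h w
validFrom h       (H₂ ∷ w)  = validFrom h w

IsSchröderPath : List Step → Set
IsSchröderPath w = T (validFrom 0 w)

countStep : Step → List Step → ℕ
countStep s []      = 0
countStep s (t ∷ w) with s ≟S t
... | yes _ = suc (countStep s w)
... | no  _ = countStep s w

semilength : List Step → ℕ
semilength w = countStep U w + countStep H₂ w

Avoids : List Step → List Step → Set
Avoids Q P = ¬ (P ⊆ Q)

-- s_n(P): Schröder paths of semilength n avoiding P
-- (a path of semilength n has length ≤ 2n, so enumerating words of
--  length ≤ 2n is exhaustive)
s : ℕ → List Step → ℕ
s n P = length (filter (λ w → (T? (validFrom 0 w) ×-dec (semilength w ≟ n))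
                                ×-dec ¬? (P ⊆? w))
                       (wordsUpTo (2 * n)))

Sch : ℕ → ℕ → ℕ
Sch n q = length (filter (λ w → (T? (validFrom 0 w) ×-dec (semilength w ≟ n))
                                  ×-dec (countStep H₂ w ≟ q))
                         (wordsUpTo (2 * n)))

data DStep : Set where
  u d : DStep

heightFrom : ℕ → List DStep → Maybe ℕ
heightFrom h       []      = just h
heightFrom h       (u ∷ w) = heightFrom (suc h) w
heightFrom zero    (d ∷ w) = nothing
heightFrom (suc h) (d ∷ w) = heightFrom h w

Pre : ℕ → ℕ → ℕ
Pre p h = length (filter (λ w → MaybeP.≡-dec _≟_ (heightFrom 0 w) (just h))
                         (wordsOfLength (u ∷ d ∷ []) p))

multichoose : ℕ → ℕ → ℕ
multichoose m i = (m + i ∸ 1) C i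

sumBelow : ℕ → (ℕ → ℕ) → ℕ
sumBelow N f = sum (map f (upTo N))

pattern-H : ℕ → List Step
pattern-H k = replicate (k ∸ 1) H₂ ++ (U ∷ D ∷ [])

-- Sort the paths by their number of steps H₂.  A path with fewer than k - 1 of them avoids the
-- pattern, which gives the first sum.  Otherwise cut the path at its (k-1)-st H₂: the path avoids
-- H₂^{k-1}UD exactly when no U follows that step, so the rest is a word in D and H₂ only.  Before
-- the cut lies a Dyck prefix of some length p and final height h with k - 2 steps H₂ inserted into
-- its p + 1 gaps; after it come h steps D and (2n - h - p - 2k + 2)/2 steps H₂ in any order.  These
-- paths are the language of a two-phase automaton, and the closed form is checked by showing that
-- it satisfies the automaton's first-step recursion.
module Submission where

open import Defs
open import Data.Bool using (Bool; true; false; T)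
open import Data.Bool.Properties using (T?)
open import Data.Empty using (⊥-elim)
open import Data.List using (List; []; _∷_; length; filter; map; concatMap; upTo; applyUpTo; _++_)
open import Data.List.Properties using (map-cong)
open import Data.List.Relation.Binary.Sublist.Propositional using (minimum; []; _∷ʳ_; _∷_)
open import Data.List.Relation.Binary.Sublist.Propositional.Properties using (∷ʳ⁻; ∷⁻)
open import Data.Maybe using (just)
import Data.Maybe.Properties as MaybeP
open import Data.Nat
open import Data.Nat.Combinatorics using (_C_; nCn≡1; nCk+nC[k+1]≡[n+1]C[k+1])
open import Data.Nat.DivMod using (_/_; m*n/n≡m)
open import Data.Nat.ListAction using (sum)
open import Data.Nat.Properties
open import Algebra.Properties.CommutativeSemigroup +-commutativeSemigroup using (interchange)
open import Data.Nat.Solver using (module +-*-Solver)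
open import Data.Product using (Σ; _×_; _,_; proj₂)
open import Data.Sum using (_⊎_; inj₁; inj₂; map₂)
open import Data.Unit using (tt)
open import Function using (_∘_)
open import Level using (0ℓ)
open import Relation.Binary.PropositionalEquality
open import Relation.Nullary using (¬_; Dec; yes; no; does)
open import Relation.Nullary.Decidable using (_×-dec_; ¬?)
open import Relation.Unary using (Pred; Decidable)
open +-*-Solver using (solve; _:+_; _:*_; _:=_; con)

module _ {A : Set} where

  count : {P : Pred A 0ℓ} → Decidable P → List A → ℕ
  count P? xs = length (filter P? xs)

  count-cong : {P Q : Pred A 0ℓ} (P? : Decidable P) (Q? : Decidable Q) →
               (∀ x → P x → Q x) → (∀ x → Q x → P x) → ∀ xs → count P? xs ≡ count Q? xs
  count-cong P? Q? P⇒Q Q⇒P [] = refl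
  count-cong P? Q? P⇒Q Q⇒P (x ∷ xs) with P? x | Q? x
  ... | yes _  | yes _  = cong suc (count-cong P? Q? P⇒Q Q⇒P xs)
  ... | yes px | no ¬qx = ⊥-elim (¬qx (P⇒Q x px))
  ... | no ¬px | yes qx = ⊥-elim (¬px (Q⇒P x qx))
  ... | no _   | no _   = count-cong P? Q? P⇒Q Q⇒P xs

  count-split : {P Q : Pred A 0ℓ} (P? : Decidable P) (Q? : Decidable Q) → ∀ xs →
                count P? xs ≡ count (λ x → P? x ×-dec Q? x) xs + count (λ x → P? x ×-dec ¬? (Q? x)) xs
  count-split P? Q? [] = refl
  count-split P? Q? (x ∷ xs) with P? x | Q? x
  ... | yes _ | yes _ = cong suc (count-split P? Q? xs)
  ... | yes _ | no _  = trans (cong suc (count-split P? Q? xs)) (sym (+-suc _ _))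
  ... | no _  | yes _ = count-split P? Q? xs
  ... | no _  | no _  = count-split P? Q? xs

  count-++ : {P : Pred A 0ℓ} (P? : Decidable P) → ∀ xs ys → count P? (xs ++ ys) ≡ count P? xs + count P? ys
  count-++ P? []       ys = refl
  count-++ P? (x ∷ xs) ys with does (P? x)
  ... | true  = cong suc (count-++ P? xs ys)
  ... | false = count-++ P? xs ys

  count-none : {P : Pred A 0ℓ} (P? : Decidable P) → (∀ x → ¬ P x) → ∀ xs → count P? xs ≡ 0
  count-none P? ¬P []       = refl
  count-none P? ¬P (x ∷ xs) with P? x
  ... | yes px = ⊥-elim (¬P x px)
  ... | no _   = count-none P? ¬P xs

count-map : ∀ {A B : Set} {P : Pred B 0ℓ} (P? : Decidable P) (f : A → B) → ∀ xs →
            count P? (map f xs) ≡ count (P? ∘ f) xs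
count-map P? f []       = refl
count-map P? f (x ∷ xs) with does (P? (f x))
... | true  = cong suc (count-map P? f xs)
... | false = count-map P? f xs

count-concatMap : ∀ {A B : Set} {P : Pred B 0ℓ} (P? : Decidable P) (f : A → List B) → ∀ xs →
                  count P? (concatMap f xs) ≡ sum (map (count P? ∘ f) xs)
count-concatMap P? f []       = refl
count-concatMap P? f (x ∷ xs) =
  trans (count-++ P? (f x) _) (cong (count P? (f x) +_) (count-concatMap P? f xs))

count-wordsOfLength-suc : ∀ {A : Set} {P : Pred (List A) 0ℓ} (P? : Decidable P) alphabet L →
  count P? (wordsOfLength alphabet (suc L))
    ≡ sum (map (λ a → count (λ w → P? (a ∷ w)) (wordsOfLength alphabet L)) alphabet)
count-wordsOfLength-suc P? alphabet L =
  trans (count-concatMap P? (λ a → map (a ∷_) (wordsOfLength alphabet L)) alphabet)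
        (cong sum (map-cong (λ a → count-map P? (a ∷_) (wordsOfLength alphabet L)) alphabet))

∑ : ℕ → (ℕ → ℕ) → ℕ
∑ zero    f = 0
∑ (suc N) f = f 0 + ∑ N (f ∘ suc)

sum-applyUpTo : ∀ (f g : ℕ → ℕ) N → sum (map f (applyUpTo g N)) ≡ ∑ N (f ∘ g)
sum-applyUpTo f g zero    = refl
sum-applyUpTo f g (suc N) = cong (f (g 0) +_) (sum-applyUpTo f (g ∘ suc) N)

sumBelow≡∑ : ∀ N f → sumBelow N f ≡ ∑ N f
sumBelow≡∑ N f = sum-applyUpTo f (λ i → i) N

∑-cong : ∀ N {f g : ℕ → ℕ} → (∀ i → i < N → f i ≡ g i) → ∑ N f ≡ ∑ N g
∑-cong zero    f≡g = refl
∑-cong (suc N) f≡g = cong₂ _+_ (f≡g 0 z<s) (∑-cong N (λ i i<N → f≡g (suc i) (s<s i<N)))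

∑-distrib-+ : ∀ N (f g : ℕ → ℕ) → ∑ N (λ i → f i + g i) ≡ ∑ N f + ∑ N g
∑-distrib-+ zero    f g = refl
∑-distrib-+ (suc N) f g =
  trans (cong (f 0 + g 0 +_) (∑-distrib-+ N (f ∘ suc) (g ∘ suc)))
        (interchange (f 0) (g 0) (∑ N (f ∘ suc)) (∑ N (g ∘ suc)))

∑-zero : ∀ N (f : ℕ → ℕ) → (∀ i → i < N → f i ≡ 0) → ∑ N f ≡ 0
∑-zero zero    f f≡0 = refl
∑-zero (suc N) f f≡0 = cong₂ _+_ (f≡0 0 z<s) (∑-zero N (f ∘ suc) (λ i i<N → f≡0 (suc i) (s<s i<N)))

∑-last : ∀ N f → ∑ (suc N) f ≡ ∑ N f + f N
∑-last zero    f = +-comm (f 0) 0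
∑-last (suc N) f = trans (cong (f 0 +_) (∑-last N (f ∘ suc))) (sym (+-assoc (f 0) _ _))

∑-drop-last : ∀ N f → f N ≡ 0 → ∑ (suc N) f ≡ ∑ N f
∑-drop-last N f fN≡0 = trans (∑-last N f) (trans (cong (∑ N f +_) fN≡0) (+-identityʳ _))

∑-drop-tail : ∀ M e f → (∀ i → M ≤ i → i < M + e → f i ≡ 0) → ∑ (M + e) f ≡ ∑ M f
∑-drop-tail M zero    f _   rewrite +-identityʳ M = refl
∑-drop-tail M (suc e) f f≡0 rewrite +-suc M e =
  trans (∑-drop-last (M + e) f (f≡0 (M + e) (m≤m+n M e) ≤-refl))
        (∑-drop-tail M e f (λ i M≤i i<M+e → f≡0 i M≤i (m<n⇒m<1+n i<M+e)))

∑-extend : ∀ M N f → M ≤ N → (∀ i → M ≤ i → i < N → f i ≡ 0) → ∑ N f ≡ ∑ M f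
∑-extend M N f M≤N f≡0 with m≤n⇒∃[o]m+o≡n M≤N
... | e , refl = ∑-drop-tail M e f f≡0

∑-cong-support : ∀ M N f g → (∀ i → i < M → i < N → f i ≡ g i) →
  (∀ i → i < N → ¬ i < M → f i ≡ 0) → (∀ i → i < M → ¬ i < N → g i ≡ 0) → ∑ N f ≡ ∑ M g
∑-cong-support M N f g f≡g f≡0 g≡0 with ≤-total M N
... | inj₁ M≤N = trans (∑-extend M N f M≤N (λ i M≤i i<N → f≡0 i i<N (≤⇒≯ M≤i)))
                       (∑-cong M (λ i i<M → f≡g i i<M (<-≤-trans i<M M≤N)))
... | inj₂ N≤M = trans (∑-cong N (λ i i<N → f≡g i (<-≤-trans i<N N≤M) i<N))
                       (sym (∑-extend N M g N≤M (λ i N≤i i<M → g≡0 i i<M (≤⇒≯ N≤i))))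

indicator : Bool → ℕ
indicator true  = 1
indicator false = 0

∑-indicator : ∀ N i₀ (g : ℕ → ℕ) → i₀ < N →
  ∑ N (λ i → indicator (i₀ ≡ᵇ i) * g i) ≡ g i₀
∑-indicator (suc N) zero     g _ =
  trans (cong₂ _+_ (+-identityʳ (g 0)) (∑-zero N _ (λ _ _ → refl))) (+-identityʳ (g 0))
∑-indicator (suc N) (suc i₀) g (s≤s i₀<N) = ∑-indicator N i₀ (g ∘ suc) i₀<N

∑-count-by-value : ∀ {A : Set} {P : Pred A 0ℓ} (P? : Decidable P) (f : A → ℕ) N xs →
  ∑ N (λ q → count (λ x → P? x ×-dec (f x ≟ q)) xs) ≡ count (λ x → P? x ×-dec (f x <? N)) xs
∑-count-by-value P? f zero    xs = sym (count-none _ (λ x → n≮0 ∘ proj₂) xs)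
∑-count-by-value P? f (suc N) xs = begin
  ∑ (suc N) (λ q → count (λ x → P? x ×-dec (f x ≟ q)) xs)
    ≡⟨ ∑-last N (λ q → count (λ x → P? x ×-dec (f x ≟ q)) xs) ⟩
  ∑ N (λ q → count (λ x → P? x ×-dec (f x ≟ q)) xs) + count (λ x → P? x ×-dec (f x ≟ N)) xs
    ≡⟨ cong₂ _+_ (trans (∑-count-by-value P? f N xs)
                        (count-cong _ _ (λ x (p , lt) → (p , m<n⇒m<1+n lt) , lt)
                                        (λ x ((p , _) , lt) → p , lt) xs))
                 (count-cong _ _ (λ x (p , e) → (p , s≤s (≤-reflexive e)) , <-irrefl e)
                                 (λ x ((p , lt) , ≮) → p , ≤-antisym (s≤s⁻¹ lt) (≮⇒≥ ≮)) xs) ⟩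
  count (λ x → (P? x ×-dec (f x <? suc N)) ×-dec (f x <? N)) xs
    + count (λ x → (P? x ×-dec (f x <? suc N)) ×-dec ¬? (f x <? N)) xs
    ≡⟨ count-split (λ x → P? x ×-dec (f x <? suc N)) (λ x → f x <? N) xs ⟨
  count (λ x → P? x ×-dec (f x <? suc N)) xs ∎
  where open ≡-Reasoning

∑∑-cong : ∀ P H {F G : ℕ → ℕ → ℕ} → (∀ p h → F p h ≡ G p h) →
  ∑ P (λ p → ∑ H (F p)) ≡ ∑ P (λ p → ∑ H (G p))
∑∑-cong P H F≡G = ∑-cong P (λ p _ → ∑-cong H (λ h _ → F≡G p h))

∑∑-zero : ∀ P H (F : ℕ → ℕ → ℕ) → (∀ p h → F p h ≡ 0) → ∑ P (λ p → ∑ H (F p)) ≡ 0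
∑∑-zero P H F F≡0 = ∑-zero P _ (λ p _ → ∑-zero H (F p) (λ h _ → F≡0 p h))

∑∑-distrib-+ : ∀ P H (F G : ℕ → ℕ → ℕ) →
  ∑ P (λ p → ∑ H (λ h → F p h + G p h)) ≡ ∑ P (λ p → ∑ H (F p)) + ∑ P (λ p → ∑ H (G p))
∑∑-distrib-+ P H F G =
  trans (∑-cong P (λ p _ → ∑-distrib-+ H (F p) (G p)))
        (∑-distrib-+ P (λ p → ∑ H (F p)) (λ p → ∑ H (G p)))

mutual
  prefixes : ℕ → ℕ → ℕ → ℕ
  prefixes h₀ zero    h = indicator (h₀ ≡ᵇ h)
  prefixes h₀ (suc p) h = prefixes (suc h₀) p h + prefixesAfterD h₀ p h

  prefixesAfterD : ℕ → ℕ → ℕ → ℕ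
  prefixesAfterD zero     p h = 0
  prefixesAfterD (suc h₀) p h = prefixes h₀ p h

count-prefixes : ∀ p h₀ h →
  count (λ w → MaybeP.≡-dec _≟_ (heightFrom h₀ w) (just h)) (wordsOfLength (u ∷ d ∷ []) p)
    ≡ prefixes h₀ p h
count-prefixes zero h₀ h with h₀ ≡ᵇ h
... | true  = refl
... | false = refl
count-prefixes (suc p) h₀ h =
  trans (count-wordsOfLength-suc (λ w → MaybeP.≡-dec _≟_ (heightFrom h₀ w) (just h)) (u ∷ d ∷ []) p)
        (cong₂ _+_ (count-prefixes p (suc h₀) h) (trans (+-identityʳ _) (startingWithD h₀)))
  where
  startingWithD : ∀ h₀ → count (λ w → MaybeP.≡-dec _≟_ (heightFrom h₀ (d ∷ w)) (just h))
                                (wordsOfLength (u ∷ d ∷ []) p) ≡ prefixesAfterD h₀ p h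
  startingWithD zero     = count-none _ (λ _ ()) (wordsOfLength (u ∷ d ∷ []) p)
  startingWithD (suc h₀) = count-prefixes p h₀ h

Pre≡prefixes : ∀ p h → Pre p h ≡ prefixes 0 p h
Pre≡prefixes p h = count-prefixes p 0 h

prefixes-vanish-or-balanced : ∀ h₀ p h →
  prefixes h₀ p h ≡ 0 ⊎ Σ ℕ (λ downs → downs ≤ p × h₀ + p ≡ h + (downs + downs))
prefixes-vanish-or-balanced h₀ zero h with h₀ ≡ᵇ h in eq
... | false = inj₁ refl
... | true  = inj₂ (0 , z≤n , trans (+-identityʳ h₀)
                                 (trans (≡ᵇ⇒≡ h₀ h (subst T (sym eq) tt)) (sym (+-identityʳ h))))
prefixes-vanish-or-balanced h₀ (suc p) h with prefixes-vanish-or-balanced (suc h₀) p h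
... | inj₂ (x , x≤p , eq) = inj₂ (x , m≤n⇒m≤1+n x≤p , trans (+-suc h₀ p) eq)
... | inj₁ up≡0 with h₀
...   | zero = inj₁ (cong (_+ 0) up≡0)
...   | suc h₀' with prefixes-vanish-or-balanced h₀' p h
...     | inj₁ down≡0 = inj₁ (cong₂ _+_ up≡0 down≡0)
...     | inj₂ (x , x≤p , eq) = inj₂ (suc x , s≤s x≤p , oneMoreDown)
  where
  oneMoreDown : suc h₀' + suc p ≡ h + (suc x + suc x)
  oneMoreDown = begin
    suc h₀' + suc p         ≡⟨ cong suc (+-suc h₀' p) ⟩
    suc (suc (h₀' + p))     ≡⟨ cong (λ y → suc (suc y)) eq ⟩
    suc (suc (h + (x + x))) ≡⟨ cong suc (+-suc h (x + x)) ⟨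
    suc (h + suc (x + x))   ≡⟨ +-suc h (suc (x + x)) ⟨
    h + suc (suc (x + x))   ≡⟨ cong (λ y → h + suc y) (sym (+-suc x x)) ⟩
    h + (suc x + suc x)     ∎
    where open ≡-Reasoning

prefixes-vanish-or-reachable : ∀ h₀ p h → prefixes h₀ p h ≡ 0 ⊎ h₀ ≤ p + h
prefixes-vanish-or-reachable h₀ p h with prefixes-vanish-or-balanced h₀ p h
... | inj₁ z = inj₁ z
... | inj₂ (x , x≤p , eq) = inj₂ (+-cancelʳ-≤ p h₀ (p + h) (begin
  h₀ + p       ≡⟨ eq ⟩
  h + (x + x)  ≤⟨ +-monoʳ-≤ h (+-mono-≤ x≤p x≤p) ⟩
  h + (p + p)  ≡⟨ solve 2 (λ p h → h :+ (p :+ p) := p :+ h :+ p) refl p h ⟩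
  p + h + p    ∎))
  where open ≤-Reasoning

tailAccepts : List Step → ℕ → ℕ → Bool
tailAccepts []        zero    zero    = true
tailAccepts []        zero    (suc m) = false
tailAccepts []        (suc h) m       = false
tailAccepts (U ∷ w)   h       m       = false
tailAccepts (D ∷ w)   zero    m       = false
tailAccepts (D ∷ w)   (suc h) m       = tailAccepts w h m
tailAccepts (H₂ ∷ w)  h       zero    = false
tailAccepts (H₂ ∷ w)  h       (suc m) = tailAccepts w h m

-- Reading from height h with semilength m to go, c more steps H₂ may occur before the marked one,
-- after which only D and H₂ are allowed.
accepts : List Step → ℕ → ℕ → ℕ → Bool
accepts []       c       h       m       = false
accepts (U ∷ w)  c       h       zero    = false
accepts (U ∷ w)  c       h       (suc m) = accepts w c (suc h) m
accepts (D ∷ w)  c       zero    m       = false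
accepts (D ∷ w)  c       (suc h) m       = accepts w c h m
accepts (H₂ ∷ w) c       h       zero    = false
accepts (H₂ ∷ w) zero    h       (suc m) = tailAccepts w h m
accepts (H₂ ∷ w) (suc c) h       (suc m) = accepts w c h m

UD : List Step
UD = U ∷ D ∷ []

semilength-H₂ : ∀ w → semilength (H₂ ∷ w) ≡ suc (semilength w)
semilength-H₂ w = +-suc (countStep U w) (countStep H₂ w)

semilength-H₂-pred : ∀ w {m} → semilength (H₂ ∷ w) ≡ suc m → semilength w ≡ m
semilength-H₂-pred w eq = suc-injective (trans (sym (semilength-H₂ w)) eq)

semilength-H₂≢0 : ∀ w → semilength (H₂ ∷ w) ≢ 0
semilength-H₂≢0 w eq = 1+n≢0 (trans (sym (semilength-H₂ w)) eq)

validFrom-U : ∀ h w → validFrom h (U ∷ w) ≡ validFrom (suc h) w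
validFrom-U zero    w = refl
validFrom-U (suc h) w = refl

validFrom-H₂ : ∀ h w → validFrom h (H₂ ∷ w) ≡ validFrom h w
validFrom-H₂ zero    w = refl
validFrom-H₂ (suc h) w = refl

D⊆-validFrom-suc : ∀ h w → T (validFrom (suc h) w) → D ∷ [] ⊆ w
D⊆-validFrom-suc h (U ∷ w)  v = U ∷ʳ D⊆-validFrom-suc (suc h) w v
D⊆-validFrom-suc h (D ∷ w)  v = refl ∷ minimum w
D⊆-validFrom-suc h (H₂ ∷ w) v = H₂ ∷ʳ D⊆-validFrom-suc h w v

countStep-≤-∷ : ∀ a b w → countStep a w ≤ countStep a (b ∷ w)
countStep-≤-∷ a b w with a ≟S b
... | yes _ = n≤1+n _
... | no  _ = ≤-refl

countStep-mono-⊆ : ∀ a {v w} → v ⊆ w → countStep a v ≤ countStep a w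
countStep-mono-⊆ a []                          = ≤-refl
countStep-mono-⊆ a (_∷ʳ_ {xs = v} {ys = w} b s) = ≤-trans (countStep-mono-⊆ a s) (countStep-≤-∷ a b w)
countStep-mono-⊆ a (_∷_ {x = b} refl s) with a ≟S b
... | yes _ = s≤s (countStep-mono-⊆ a s)
... | no  _ = countStep-mono-⊆ a s

countStep-H₂-pattern : ∀ c → countStep H₂ (pattern-H (suc (suc c))) ≡ suc c
countStep-H₂-pattern zero    = refl
countStep-H₂-pattern (suc c) = cong suc (countStep-H₂-pattern c)

avoids-if-few-H₂ : ∀ c w → countStep H₂ w < suc c → ¬ pattern-H (suc (suc c)) ⊆ w
avoids-if-few-H₂ c w lt s =
  <⇒≱ lt (subst (_≤ countStep H₂ w) (countStep-H₂-pattern c) (countStep-mono-⊆ H₂ s))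

tailAccepts-sound : ∀ w h m → T (tailAccepts w h m) →
  T (validFrom h w) × semilength w ≡ m × ¬ UD ⊆ w
tailAccepts-sound []       zero    zero    t = tt , refl , λ ()
tailAccepts-sound (D ∷ w)  (suc h) m       t with tailAccepts-sound w h m t
... | v , e , a = v , e , a ∘ ∷ʳ⁻ λ ()
tailAccepts-sound (H₂ ∷ w) h       (suc m) t with tailAccepts-sound w h m t
... | v , e , a = subst T (sym (validFrom-H₂ h w)) v , trans (semilength-H₂ w) (cong suc e) , a ∘ ∷ʳ⁻ λ ()

tailAccepts-complete : ∀ w h m → T (validFrom h w) → semilength w ≡ m → ¬ UD ⊆ w →
  T (tailAccepts w h m)
tailAccepts-complete []       zero    zero    v e a = tt
tailAccepts-complete (U ∷ w)  h       m       v e a =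
  ⊥-elim (a (refl ∷ D⊆-validFrom-suc h w (subst T (validFrom-U h w) v)))
tailAccepts-complete (D ∷ w)  (suc h) m       v e a = tailAccepts-complete w h m v e (a ∘ (D ∷ʳ_))
tailAccepts-complete (H₂ ∷ w) h       zero    v e a = ⊥-elim (semilength-H₂≢0 w e)
tailAccepts-complete (H₂ ∷ w) h       (suc m) v e a =
  tailAccepts-complete w h m (subst T (validFrom-H₂ h w) v) (semilength-H₂-pred w e) (a ∘ (H₂ ∷ʳ_))

accepts-sound : ∀ w c h m → T (accepts w c h m) →
  T (validFrom h w) × semilength w ≡ m × ¬ pattern-H (suc (suc c)) ⊆ w × suc c ≤ countStep H₂ w
accepts-sound (U ∷ w)  c       h       (suc m) t with accepts-sound w c (suc h) m t
... | v , e , a , n = subst T (sym (validFrom-U h w)) v , cong suc e , a ∘ ∷ʳ⁻ (λ ()) , n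
accepts-sound (D ∷ w)  c       (suc h) m       t with accepts-sound w c h m t
... | v , e , a , n = v , e , a ∘ ∷ʳ⁻ (λ ()) , n
accepts-sound (H₂ ∷ w) zero    h       (suc m) t with tailAccepts-sound w h m t
... | v , e , a =
  subst T (sym (validFrom-H₂ h w)) v , trans (semilength-H₂ w) (cong suc e) , a ∘ ∷⁻ , s≤s z≤n
accepts-sound (H₂ ∷ w) (suc c) h       (suc m) t with accepts-sound w c h m t
... | v , e , a , n =
  subst T (sym (validFrom-H₂ h w)) v , trans (semilength-H₂ w) (cong suc e) , a ∘ ∷⁻ , s≤s n

accepts-complete : ∀ w c h m → T (validFrom h w) → semilength w ≡ m →
  ¬ pattern-H (suc (suc c)) ⊆ w → suc c ≤ countStep H₂ w → T (accepts w c h m)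
accepts-complete (U ∷ w)  c       h       zero    v () a n
accepts-complete (U ∷ w)  c       h       (suc m) v e a n =
  accepts-complete w c (suc h) m (subst T (validFrom-U h w) v) (suc-injective e) (a ∘ (U ∷ʳ_)) n
accepts-complete (D ∷ w)  c       (suc h) m       v e a n = accepts-complete w c h m v e (a ∘ (D ∷ʳ_)) n
accepts-complete (H₂ ∷ w) c       h       zero    v e a n = ⊥-elim (semilength-H₂≢0 w e)
accepts-complete (H₂ ∷ w) zero    h       (suc m) v e a n =
  tailAccepts-complete w h m (subst T (validFrom-H₂ h w) v) (semilength-H₂-pred w e) (a ∘ (refl ∷_))
accepts-complete (H₂ ∷ w) (suc c) h       (suc m) v e a (s≤s n) =
  accepts-complete w c h m (subst T (validFrom-H₂ h w) v) (semilength-H₂-pred w e) (a ∘ (refl ∷_)) n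

acceptedOfLength : (List Step → Bool) → ℕ → ℕ
acceptedOfLength g L = count (λ w → T? (g w)) (wordsOfLength allSteps L)

acceptedUpTo : ℕ → (List Step → Bool) → ℕ
acceptedUpTo f g = ∑ (suc f) (acceptedOfLength g)

acceptedOfLength-zero : ∀ g → acceptedOfLength g 0 ≡ indicator (g [])
acceptedOfLength-zero g with g []
... | true  = refl
... | false = refl

acceptedUpTo-suc : ∀ f g → acceptedUpTo (suc f) g
  ≡ indicator (g []) + (acceptedUpTo f (λ w → g (U ∷ w))
                         + (acceptedUpTo f (λ w → g (D ∷ w)) + acceptedUpTo f (λ w → g (H₂ ∷ w))))
acceptedUpTo-suc f g = cong₂ _+_ (acceptedOfLength-zero g) (begin
  ∑ (suc f) (λ L → acceptedOfLength g (suc L))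
    ≡⟨ ∑-cong (suc f) (λ L _ → byFirstStep L) ⟩
  ∑ (suc f) (λ L → acceptedOfLength gU L + (acceptedOfLength gD L + acceptedOfLength gH L))
    ≡⟨ ∑-distrib-+ (suc f) (acceptedOfLength gU) (λ L → acceptedOfLength gD L + acceptedOfLength gH L) ⟩
  acceptedUpTo f gU + ∑ (suc f) (λ L → acceptedOfLength gD L + acceptedOfLength gH L)
    ≡⟨ cong (acceptedUpTo f gU +_) (∑-distrib-+ (suc f) (acceptedOfLength gD) (acceptedOfLength gH)) ⟩
  acceptedUpTo f gU + (acceptedUpTo f gD + acceptedUpTo f gH) ∎)
  where
  open ≡-Reasoning
  gU gD gH : List Step → Bool
  gU w = g (U ∷ w)
  gD w = g (D ∷ w)
  gH w = g (H₂ ∷ w)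
  byFirstStep : ∀ L → acceptedOfLength g (suc L)
                    ≡ acceptedOfLength gU L + (acceptedOfLength gD L + acceptedOfLength gH L)
  byFirstStep L = trans (count-wordsOfLength-suc (λ w → T? (g w)) allSteps L)
                        (cong (λ x → acceptedOfLength gU L + (acceptedOfLength gD L + x)) (+-identityʳ _))

acceptedUpTo-none : ∀ f → acceptedUpTo f (λ _ → false) ≡ 0
acceptedUpTo-none f =
  ∑-zero (suc f) (acceptedOfLength (λ _ → false)) (λ L _ → count-none _ (λ _ ()) (wordsOfLength allSteps L))

acceptedUpTo-tailAccepts : ∀ f h m → h + m ≤ f → acceptedUpTo f (λ w → tailAccepts w h m) ≡ (h + m) C h
acceptedUpTo-tailAccepts zero    zero    zero    _ = refl
acceptedUpTo-tailAccepts (suc f) h       m       hm≤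
  rewrite acceptedUpTo-suc f (λ w → tailAccepts w h m) | acceptedUpTo-none f = byFirstStep h m hm≤
  where
  byFirstStep : ∀ h m → h + m ≤ suc f →
    indicator (tailAccepts [] h m)
      + (0 + (acceptedUpTo f (λ w → tailAccepts (D ∷ w) h m) + acceptedUpTo f (λ w → tailAccepts (H₂ ∷ w) h m)))
      ≡ (h + m) C h
  byFirstStep zero    zero    _   rewrite acceptedUpTo-none f = refl
  byFirstStep zero    (suc m) hm≤ rewrite acceptedUpTo-none f = acceptedUpTo-tailAccepts f 0 m (s≤s⁻¹ hm≤)
  byFirstStep (suc h) zero    hm≤
    rewrite acceptedUpTo-none f | acceptedUpTo-tailAccepts f h 0 (s≤s⁻¹ hm≤) | +-identityʳ h =
    trans (+-identityʳ _) (trans (nCn≡1 h) (sym (nCn≡1 (suc h))))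
  byFirstStep (suc h) (suc m) hm≤
    rewrite acceptedUpTo-tailAccepts f h (suc m) (s≤s⁻¹ hm≤)
          | acceptedUpTo-tailAccepts f (suc h) m (subst (_≤ f) (+-suc h m) (s≤s⁻¹ hm≤))
          | +-suc h m =
    nCk+nC[k+1]≡[n+1]C[k+1] (suc (h + m)) h

multichoose-1 : ∀ c → multichoose 1 c ≡ 1
multichoose-1 = nCn≡1

multichoose-pascal : ∀ p c →
  multichoose (2 + p) (suc c) ≡ multichoose (suc p) (suc c) + multichoose (2 + p) c
multichoose-pascal p c = begin
  suc (p + suc c) C suc c               ≡⟨ cong (λ z → suc z C suc c) (+-suc p c) ⟩
  suc (suc (p + c)) C suc c             ≡⟨ nCk+nC[k+1]≡[n+1]C[k+1] (suc (p + c)) c ⟨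
  suc (p + c) C c + suc (p + c) C suc c ≡⟨ +-comm (suc (p + c) C c) _ ⟩
  suc (p + c) C suc c + suc (p + c) C c ≡⟨ cong (λ z → z C suc c + suc (p + c) C c) (+-suc p c) ⟨
  (p + suc c) C suc c + suc (p + c) C c ∎
  where open ≡-Reasoning

halfBinom : ℕ → ℕ → ℕ → ℕ
halfBinom h j zero          = (h + j) C h
halfBinom h j (suc zero)    = 0
halfBinom h j (suc (suc r)) = halfBinom h (suc j) r

-- tailWays h (B + 2m) B = C(h + m, h) counts the {D, H₂}-words from height h down to 0 with
-- m steps H₂; it vanishes when A < B or A - B is odd.
tailWays : ℕ → ℕ → ℕ → ℕ
tailWays h A       zero    = halfBinom h 0 A
tailWays h zero    (suc B) = 0
tailWays h (suc A) (suc B) = tailWays h A B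

tailWays-below : ∀ h A B → A < B → tailWays h A B ≡ 0
tailWays-below h zero    (suc B) _         = refl
tailWays-below h (suc A) (suc B) (s≤s A<B) = tailWays-below h A B A<B

tailWays-shift : ∀ h k {A A' B B'} → A ≡ k + A' → B ≡ k + B' → tailWays h A B ≡ tailWays h A' B'
tailWays-shift h zero    refl refl = refl
tailWays-shift h (suc k) refl refl = tailWays-shift h k refl refl

halfBinom-double : ∀ h j i → halfBinom h j (i + i) ≡ (h + (j + i)) C h
halfBinom-double h j zero    = cong (λ z → (h + z) C h) (sym (+-identityʳ j))
halfBinom-double h j (suc i) rewrite +-suc i i =
  trans (halfBinom-double h (suc j) i) (cong (λ z → (h + z) C h) (sym (+-suc j i)))

tailWays-double : ∀ h i → tailWays h (i + i) 0 ≡ (h + i) C h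
tailWays-double h i = halfBinom-double h 0 i

weighted-tailWays-vanish : ∀ {x} y h A B → x ≡ 0 ⊎ A < B → x * y * tailWays h A B ≡ 0
weighted-tailWays-vanish     y h A B (inj₁ refl) = refl
weighted-tailWays-vanish {x} y h A B (inj₂ A<B)  =
  trans (cong (x * y *_) (tailWays-below h A B A<B)) (*-zeroʳ (x * y))

-- An accepted word is a Dyck prefix of length p from h₀ to h with c steps H₂ inserted into its
-- p + 1 gaps, the marked H₂, and a tail.  The prefix has (p + h - h₀)/2 steps U, so with A = 2m + h₀
-- the tail has (A - (p + h + 2c + 2))/2 steps H₂.
term : ℕ → ℕ → ℕ → ℕ → ℕ → ℕ
term c h₀ A p h = prefixes h₀ p h * multichoose (suc p) c * tailWays h A (2 + (p + h + (c + c)))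

closedForm : ℕ → ℕ → ℕ → ℕ
closedForm c h₀ A = ∑ A (λ p → ∑ A (term c h₀ A p))

term-vanishes-beyond : ∀ c h₀ A p h → A ≤ p + h → term c h₀ A p h ≡ 0
term-vanishes-beyond c h₀ A p h A≤p+h =
  weighted-tailWays-vanish {prefixes h₀ p h} (multichoose (suc p) c) h A _
    (inj₂ (s≤s (m≤n⇒m≤1+n (m≤n⇒m≤n+o (c + c) A≤p+h))))

closedForm-bounds : ∀ P H c h₀ A → A ≤ P → A ≤ H →
  ∑ P (λ p → ∑ H (term c h₀ A p)) ≡ closedForm c h₀ A
closedForm-bounds P H c h₀ A A≤P A≤H =
  trans (∑-extend A P _ A≤P (λ p A≤p _ →
          ∑-zero H (term c h₀ A p) (λ h _ → term-vanishes-beyond c h₀ A p h (m≤n⇒m≤n+o h A≤p))))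
        (∑-cong A (λ p _ → ∑-extend A H (term c h₀ A p) A≤H (λ h A≤h _ →
          term-vanishes-beyond c h₀ A p h (m≤n⇒m≤o+n p A≤h))))

-- Words starting with H₂ contribute the row p = 0 and, by Pascal's rule for the multiset
-- coefficient, the part laterH₂ of the rows p ≥ 1.
firstU firstD laterH₂ firstH₂ : ℕ → ℕ → ℕ → ℕ
firstU c h₀ A = ∑ A λ p → ∑ (suc A) λ h →
  prefixes (suc h₀) p h * multichoose (suc p) c * tailWays h A (3 + (p + h + (c + c)))
firstD c h₀ A = ∑ A λ p → ∑ (suc A) λ h →
  prefixesAfterD h₀ p h * multichoose (suc p) c * tailWays h A (3 + (p + h + (c + c)))
laterH₂ zero    h₀ A = 0
laterH₂ (suc c) h₀ A = ∑ A λ p → ∑ (suc A) λ h →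
  prefixes h₀ (suc p) h * multichoose (2 + p) c * tailWays h A (3 + (p + h + (suc c + suc c)))
firstH₂ c h₀ A = ∑ (suc A) (term c h₀ A 0) + laterH₂ c h₀ A

later-rows : ∀ c h₀ A →
  ∑ A (λ p → ∑ (suc A) (term c h₀ A (suc p))) ≡ firstU c h₀ A + firstD c h₀ A + laterH₂ c h₀ A
later-rows zero h₀ A = begin
  ∑ A (λ p → ∑ (suc A) (term zero h₀ A (suc p)))
    ≡⟨ ∑∑-cong A (suc A) split ⟩
  ∑ A (λ p → ∑ (suc A) (λ h → up p h + down p h))
    ≡⟨ ∑∑-distrib-+ A (suc A) up down ⟩
  firstU zero h₀ A + firstD zero h₀ A
    ≡⟨ +-identityʳ _ ⟨
  firstU zero h₀ A + firstD zero h₀ A + 0 ∎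
  where
  open ≡-Reasoning
  up down : ℕ → ℕ → ℕ
  up p h = prefixes (suc h₀) p h * 1 * tailWays h A (3 + (p + h + 0))
  down p h = prefixesAfterD h₀ p h * 1 * tailWays h A (3 + (p + h + 0))
  split : ∀ p h → term zero h₀ A (suc p) h ≡ up p h + down p h
  split p h = solve 3 (λ a b g → (a :+ b) :* con 1 :* g := a :* con 1 :* g :+ b :* con 1 :* g)
    refl (prefixes (suc h₀) p h) (prefixesAfterD h₀ p h) (tailWays h A (3 + (p + h + 0)))
later-rows (suc c) h₀ A = begin
  ∑ A (λ p → ∑ (suc A) (term (suc c) h₀ A (suc p)))
    ≡⟨ ∑∑-cong A (suc A) pascalSplit ⟩
  ∑ A (λ p → ∑ (suc A) (λ h → up p h + down p h + flat p h))
    ≡⟨ ∑∑-distrib-+ A (suc A) (λ p h → up p h + down p h) flat ⟩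
  ∑ A (λ p → ∑ (suc A) (λ h → up p h + down p h)) + laterH₂ (suc c) h₀ A
    ≡⟨ cong (_+ laterH₂ (suc c) h₀ A) (∑∑-distrib-+ A (suc A) up down) ⟩
  firstU (suc c) h₀ A + firstD (suc c) h₀ A + laterH₂ (suc c) h₀ A ∎
  where
  open ≡-Reasoning
  B : ℕ → ℕ → ℕ
  B p h = 3 + (p + h + (suc c + suc c))
  up down flat : ℕ → ℕ → ℕ
  up p h = prefixes (suc h₀) p h * multichoose (suc p) (suc c) * tailWays h A (B p h)
  down p h = prefixesAfterD h₀ p h * multichoose (suc p) (suc c) * tailWays h A (B p h)
  flat p h = prefixes h₀ (suc p) h * multichoose (2 + p) c * tailWays h A (B p h)
  pascalSplit : ∀ p h → term (suc c) h₀ A (suc p) h ≡ up p h + down p h + flat p h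
  pascalSplit p h rewrite multichoose-pascal p c =
    solve 5 (λ a b x y g → (a :+ b) :* (x :+ y) :* g := a :* x :* g :+ b :* x :* g :+ (a :+ b) :* y :* g)
      refl (prefixes (suc h₀) p h) (prefixesAfterD h₀ p h)
      (multichoose (suc p) (suc c)) (multichoose (2 + p) c) (tailWays h A (B p h))

closedForm-by-first-step : ∀ c h₀ A →
  closedForm c h₀ A ≡ firstU c h₀ A + (firstD c h₀ A + firstH₂ c h₀ A)
closedForm-by-first-step c h₀ A = begin
  closedForm c h₀ A
    ≡⟨ closedForm-bounds (suc A) (suc A) c h₀ A (n≤1+n A) (n≤1+n A) ⟨
  ∑ (suc A) (term c h₀ A 0) + ∑ A (λ p → ∑ (suc A) (term c h₀ A (suc p)))
    ≡⟨ cong (∑ (suc A) (term c h₀ A 0) +_) (later-rows c h₀ A) ⟩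
  ∑ (suc A) (term c h₀ A 0) + (firstU c h₀ A + firstD c h₀ A + laterH₂ c h₀ A)
    ≡⟨ solve 4 (λ r u d l → r :+ (u :+ d :+ l) := u :+ (d :+ (r :+ l))) refl
         (∑ (suc A) (term c h₀ A 0)) (firstU c h₀ A) (firstD c h₀ A) (laterH₂ c h₀ A) ⟩
  firstU c h₀ A + (firstD c h₀ A + firstH₂ c h₀ A) ∎
  where open ≡-Reasoning

ClosedFormBelow : ℕ → Set
ClosedFormBelow f = ∀ c h₀ m → m + m + h₀ ≤ f →
  acceptedUpTo f (λ w → accepts w c h₀ m) ≡ closedForm c h₀ (m + m + h₀)

double-suc-+ : ∀ m h → suc m + suc m + h ≡ 2 + (m + m + h)
double-suc-+ m h = cong (λ z → suc (z + h)) (+-suc m m)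

+-double-suc : ∀ x c → x + (suc c + suc c) ≡ 2 + (x + (c + c))
+-double-suc x c = trans (+-suc x (c + suc c)) (cong suc (trans (cong (x +_) (+-suc c c)) (+-suc x (c + c))))

accepted-firstU : ∀ f → ClosedFormBelow f → ∀ c h₀ m → m + m + h₀ ≤ suc f →
  acceptedUpTo f (λ w → accepts (U ∷ w) c h₀ m) ≡ firstU c h₀ (m + m + h₀)
accepted-firstU f ih c h₀ zero    _ = trans (acceptedUpTo-none f) (sym (∑∑-zero h₀ (suc h₀) _ (λ p h →
  weighted-tailWays-vanish (multichoose (suc p) c) h h₀ _
    (map₂ (λ le → m≤n⇒m≤o+n 3 (m≤n⇒m≤n+o (c + c) le)) (prefixes-vanish-or-reachable (suc h₀) p h)))))
accepted-firstU f ih c h₀ (suc m) le = begin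
  acceptedUpTo f (λ w → accepts w c (suc h₀) m)
    ≡⟨ ih c (suc h₀) m (s≤s⁻¹ (subst (_≤ suc f) A≡1+A' le)) ⟩
  closedForm c (suc h₀) A'
    ≡⟨ closedForm-bounds A (suc A) c (suc h₀) A' A'≤A (m≤n⇒m≤1+n A'≤A) ⟨
  ∑ A (λ p → ∑ (suc A) (term c (suc h₀) A' p))
    ≡⟨ ∑∑-cong A (suc A) (λ p h → cong (prefixes (suc h₀) p h * multichoose (suc p) c *_)
                                       (tailWays-shift h 1 {B' = 2 + (p + h + (c + c))} A≡1+A' refl)) ⟨
  firstU c h₀ A ∎
  where
  open ≡-Reasoning
  A = suc m + suc m + h₀
  A' = m + m + suc h₀
  A≡1+A' : A ≡ 1 + A'
  A≡1+A' = trans (double-suc-+ m h₀) (cong suc (sym (+-suc (m + m) h₀)))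
  A'≤A : A' ≤ A
  A'≤A = subst (A' ≤_) (sym A≡1+A') (n≤1+n A')

accepted-firstD : ∀ f → ClosedFormBelow f → ∀ c h₀ m → m + m + h₀ ≤ suc f →
  acceptedUpTo f (λ w → accepts (D ∷ w) c h₀ m) ≡ firstD c h₀ (m + m + h₀)
accepted-firstD f ih c zero     m _  =
  trans (acceptedUpTo-none f) (sym (∑∑-zero (m + m + 0) (suc (m + m + 0)) _ (λ _ _ → refl)))
accepted-firstD f ih c (suc h₀) m le = begin
  acceptedUpTo f (λ w → accepts w c h₀ m)
    ≡⟨ ih c h₀ m (s≤s⁻¹ (subst (_≤ suc f) A≡1+A' le)) ⟩
  closedForm c h₀ A'
    ≡⟨ closedForm-bounds A (suc A) c h₀ A' A'≤A (m≤n⇒m≤1+n A'≤A) ⟨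
  ∑ A (λ p → ∑ (suc A) (term c h₀ A' p))
    ≡⟨ ∑∑-cong A (suc A) (λ p h → cong (prefixes h₀ p h * multichoose (suc p) c *_)
                                       (tailWays-shift h 1 {B' = 2 + (p + h + (c + c))} A≡1+A' refl)) ⟨
  firstD c (suc h₀) A ∎
  where
  open ≡-Reasoning
  A = m + m + suc h₀
  A' = m + m + h₀
  A≡1+A' : A ≡ 1 + A'
  A≡1+A' = +-suc (m + m) h₀
  A'≤A : A' ≤ A
  A'≤A = subst (A' ≤_) (sym A≡1+A') (n≤1+n A')

firstH₂-vanishes-at-A≡h₀ : ∀ c h₀ → firstH₂ c h₀ h₀ ≡ 0
firstH₂-vanishes-at-A≡h₀ c h₀ = cong₂ _+_
  (∑-zero (suc h₀) (term c h₀ h₀ 0) (λ h _ → weighted-tailWays-vanish (multichoose 1 c) h h₀ _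
    (map₂ (λ le → s≤s (m≤n⇒m≤1+n (m≤n⇒m≤n+o (c + c) le))) (prefixes-vanish-or-reachable h₀ 0 h))))
  (laterVanish c)
  where
  laterVanish : ∀ c → laterH₂ c h₀ h₀ ≡ 0
  laterVanish zero    = refl
  laterVanish (suc c) = ∑∑-zero h₀ (suc h₀) _ (λ p h → weighted-tailWays-vanish (multichoose (2 + p) c) h h₀ _
    (map₂ (λ le → s≤s (m≤n⇒m≤1+n (≤-trans le (s≤s (m≤n⇒m≤n+o (suc c + suc c) ≤-refl)))))
          (prefixes-vanish-or-reachable h₀ (suc p) h)))

accepted-firstH₂ : ∀ f → ClosedFormBelow f → ∀ c h₀ m → m + m + h₀ ≤ suc f →
  acceptedUpTo f (λ w → accepts (H₂ ∷ w) c h₀ m) ≡ firstH₂ c h₀ (m + m + h₀)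
accepted-firstH₂ f ih c       h₀ zero    _  =
  trans (acceptedUpTo-none f) (sym (firstH₂-vanishes-at-A≡h₀ c h₀))
accepted-firstH₂ f ih zero    h₀ (suc m) le = begin
  acceptedUpTo f (λ w → tailAccepts w h₀ m)
    ≡⟨ acceptedUpTo-tailAccepts f h₀ m tailFits ⟩
  (h₀ + m) C h₀
    ≡⟨ tailWays-double h₀ m ⟨
  tailWays h₀ (m + m) 0
    ≡⟨ tailWays-shift h₀ (2 + h₀) A≡ refl ⟨
  tailWays h₀ A (2 + (h₀ + 0))
    ≡⟨ ∑-indicator (suc A) h₀ (λ h → tailWays h A (2 + (h + 0))) (s≤s (m≤n+m h₀ (suc m + suc m))) ⟨
  ∑ (suc A) (λ h → indicator (h₀ ≡ᵇ h) * tailWays h A (2 + (h + 0)))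
    ≡⟨ ∑-cong (suc A) (λ h _ → cong (_* tailWays h A (2 + (h + 0))) (*-identityʳ (indicator (h₀ ≡ᵇ h)))) ⟨
  ∑ (suc A) (term zero h₀ A 0)
    ≡⟨ +-identityʳ _ ⟨
  firstH₂ zero h₀ A ∎
  where
  open ≡-Reasoning
  A = suc m + suc m + h₀
  A≡ : A ≡ 2 + h₀ + (m + m)
  A≡ = solve 2 (λ m h₀ → (con 1 :+ m) :+ (con 1 :+ m) :+ h₀ := con 2 :+ h₀ :+ (m :+ m)) refl m h₀
  tailFits : h₀ + m ≤ f
  tailFits = ≤-trans (≤-trans (+-monoʳ-≤ h₀ (m≤n+m m m)) (≤-reflexive (+-comm h₀ (m + m))))
                     (≤-trans (n≤1+n _) (s≤s⁻¹ (subst (_≤ suc f) (double-suc-+ m h₀) le)))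
accepted-firstH₂ f ih (suc c) h₀ (suc m) le = begin
  acceptedUpTo f (λ w → accepts w c h₀ m)
    ≡⟨ ih c h₀ m (≤-trans (n≤1+n A') (s≤s⁻¹ (subst (_≤ suc f) A≡2+A' le))) ⟩
  closedForm c h₀ A'
    ≡⟨ closedForm-bounds (suc A) (suc A) c h₀ A' A'≤1+A A'≤1+A ⟨
  ∑ (suc A) (λ p → ∑ (suc A) (term c h₀ A' p))
    ≡⟨ cong₂ _+_ (∑-cong (suc A) (λ h _ → cong₂ (λ x y → prefixes h₀ 0 h * x * y)
                   (trans (multichoose-1 (suc c)) (sym (multichoose-1 c)))
                   (tailWays-shift h 2 A≡2+A' (cong (2 +_) (+-double-suc h c)))))
                 (∑∑-cong A (suc A) (λ p h → cong (prefixes h₀ (suc p) h * multichoose (2 + p) c *_)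
                   (tailWays-shift h 2 A≡2+A' (cong (3 +_) (+-double-suc (p + h) c))))) ⟨
  firstH₂ (suc c) h₀ A ∎
  where
  open ≡-Reasoning
  A = suc m + suc m + h₀
  A' = m + m + h₀
  A≡2+A' : A ≡ 2 + A'
  A≡2+A' = double-suc-+ m h₀
  A'≤1+A : A' ≤ suc A
  A'≤1+A = subst (A' ≤_) (cong suc (sym A≡2+A')) (≤-trans (n≤1+n A') (≤-trans (n≤1+n _) (n≤1+n _)))

acceptedUpTo-closedForm : ∀ f → ClosedFormBelow f
acceptedUpTo-closedForm zero    c zero zero z≤n = refl
acceptedUpTo-closedForm (suc f) c h₀   m  le = begin
  acceptedUpTo (suc f) (λ w → accepts w c h₀ m)
    ≡⟨ acceptedUpTo-suc f (λ w → accepts w c h₀ m) ⟩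
  0 + (acceptedUpTo f (λ w → accepts (U ∷ w) c h₀ m)
       + (acceptedUpTo f (λ w → accepts (D ∷ w) c h₀ m) + acceptedUpTo f (λ w → accepts (H₂ ∷ w) c h₀ m)))
    ≡⟨ cong₂ _+_ (accepted-firstU f ih c h₀ m le)
                 (cong₂ _+_ (accepted-firstD f ih c h₀ m le) (accepted-firstH₂ f ih c h₀ m le)) ⟩
  firstU c h₀ A + (firstD c h₀ A + firstH₂ c h₀ A)
    ≡⟨ closedForm-by-first-step c h₀ A ⟨
  closedForm c h₀ A ∎
  where
  open ≡-Reasoning
  A = m + m + h₀
  ih = acceptedUpTo-closedForm f

m<o∸n⇒m+n<o : ∀ m n o → m < o ∸ n → m + n < o
m<o∸n⇒m+n<o m n o lt with n ≤? o
... | yes n≤o = m≤o∸n⇒m+n≤o (suc m) n≤o lt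
... | no  n≰o = ⊥-elim (n≮0 (subst (m <_) (m≤n⇒m∸n≡0 (<⇒≤ (≰⇒> n≰o))) lt))

m≮o∸n⇒o≤n+m : ∀ m n o → ¬ m < o ∸ n → o ≤ n + m
m≮o∸n⇒o≤n+m m n o ≮ = ≤-trans (m≤n+m∸n o n) (+-monoʳ-≤ n (≮⇒≥ ≮))

below-when-room : ∀ n i t → i + t < 2 * n + 3 → 4 ≤ t → i < n + n + 0
below-when-room n i t lt 4≤t = +-cancelʳ-< 3 i (n + n + 0) (begin-strict
  i + 3           <⟨ +-monoʳ-< i 4≤t ⟩
  i + t           <⟨ lt ⟩
  2 * n + 3       ≡⟨ solve 1 (λ n → con 2 :* n :+ con 3 := n :+ n :+ con 0 :+ con 3) refl n ⟩
  n + n + 0 + 3   ∎)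
  where open ≤-Reasoning

tail-too-long : ∀ n K p h → 2 * n + 3 ≤ p + 2 * (2 + K) + h → n + n + 0 < 2 + (p + h + (K + K))
tail-too-long n K p h le = +-cancelʳ-≤ 2 _ _ (begin
  suc (n + n + 0) + 2       ≡⟨ solve 1 (λ n → con 1 :+ (n :+ n :+ con 0) :+ con 2 := con 2 :* n :+ con 3)
                                       refl n ⟩
  2 * n + 3                ≤⟨ le ⟩
  p + 2 * (2 + K) + h      ≡⟨ solve 3 (λ p h K → p :+ con 2 :* (con 2 :+ K) :+ h
                                                := con 2 :+ (p :+ h :+ (K :+ K)) :+ con 2) refl p h K ⟩
  2 + (p + h + (K + K)) + 2 ∎)
  where open ≤-Reasoning

tail-count-as-stated : ∀ n K p h x j → p ≡ h + (x + x) → n ≡ h + x + K + 1 + j →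
  tailWays h (n + n + 0) (2 + (p + h + (K + K))) ≡ multichoose ((2 * n + 4 ∸ (h + p + 2 * (2 + K))) / 2) h
tail-count-as-stated _ K _ h x j refl refl = begin
  tailWays h (n + n + 0) B                 ≡⟨ tailWays-shift h B A≡B+2j (sym (+-identityʳ B)) ⟩
  tailWays h (j + j) 0                     ≡⟨ tailWays-double h j ⟩
  (h + j) C h                              ≡⟨ cong (_C h) (+-comm h j) ⟩
  multichoose (suc j) h                    ≡⟨ cong (λ z → multichoose z h) (m*n/n≡m (suc j) 2) ⟨
  multichoose (suc j * 2 / 2) h            ≡⟨ cong (λ z → multichoose (z / 2) h) (m+n∸m≡n S (suc j * 2)) ⟨
  multichoose ((S + suc j * 2 ∸ S) / 2) h  ≡⟨ cong (λ z → multichoose ((z ∸ S) / 2) h) S+2j+2≡2n+4 ⟩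
  multichoose ((2 * n + 4 ∸ S) / 2) h      ∎
  where
  open ≡-Reasoning
  n = h + x + K + 1 + j
  B = 2 + (h + (x + x) + h + (K + K))
  S = h + (h + (x + x)) + 2 * (2 + K)
  A≡B+2j : n + n + 0 ≡ B + (j + j)
  A≡B+2j = solve 4 (λ h x K j → (h :+ x :+ K :+ con 1 :+ j) :+ (h :+ x :+ K :+ con 1 :+ j) :+ con 0
                              := con 2 :+ ((h :+ (x :+ x)) :+ h :+ (K :+ K)) :+ (j :+ j)) refl h x K j
  S+2j+2≡2n+4 : S + suc j * 2 ≡ 2 * n + 4
  S+2j+2≡2n+4 = solve 4 (λ h x K j → h :+ (h :+ (x :+ x)) :+ con 2 :* (con 2 :+ K) :+ (con 1 :+ j) :* con 2
                                   := con 2 :* (h :+ x :+ K :+ con 1 :+ j) :+ con 4) refl h x K j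

tail-fits : ∀ n K p h x → p ≡ h + (x + x) → h + (p + 2 * (2 + K)) < 2 * n + 3 → h + x + K + 1 ≤ n
tail-fits n K _ h x refl lt = *-cancelˡ-≤ 2 (+-cancelʳ-≤ 3 _ _ (begin
  2 * (h + x + K + 1) + 3               ≡⟨ solve 3 (λ h x K → con 2 :* (h :+ x :+ K :+ con 1) :+ con 3
                                             := con 1 :+ (h :+ (h :+ (x :+ x) :+ con 2 :* (con 2 :+ K))))
                                             refl h x K ⟩
  suc (h + (h + (x + x) + 2 * (2 + K))) ≤⟨ lt ⟩
  2 * n + 3                             ∎))
  where open ≤-Reasoning

term-as-stated : ∀ n K p h → h + (p + 2 * (2 + K)) < 2 * n + 3 →
  term K 0 (n + n + 0) p h
    ≡ Pre p h * multichoose (p + 1) K * multichoose ((2 * n + 4 ∸ (h + p + 2 * (2 + K))) / 2) h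
term-as-stated n K p h lt rewrite Pre≡prefixes p h with prefixes-vanish-or-balanced 0 p h
... | inj₁ none rewrite none = refl
... | inj₂ (x , _ , p≡) with m≤n⇒∃[o]m+o≡n (tail-fits n K p h x p≡ lt)
...   | j , n≡ = cong₂ (λ a b → prefixes 0 p h * a * b) (cong (λ z → multichoose z K) (+-comm 1 p))
                       (tail-count-as-stated n K p h x j p≡ (sym n≡))

4≤2*[2+K] : ∀ K → 4 ≤ 2 * (2 + K)
4≤2*[2+K] K = *-monoʳ-≤ 2 (m≤m+n 2 K)

closedForm-as-stated : ∀ n K →
  closedForm K 0 (n + n + 0)
    ≡ sumBelow (2 * n + 3 ∸ 2 * (2 + K)) (λ p →
        sumBelow (2 * n + 3 ∸ (p + 2 * (2 + K))) (λ h →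
          Pre p h * multichoose (p + 1) K * multichoose ((2 * n + 4 ∸ (h + p + 2 * (2 + K))) / 2) h))
closedForm-as-stated n K = begin
  closedForm K 0 A
    ≡⟨ ∑-cong-support M A (λ p → ∑ A (term K 0 A p)) (λ p → ∑ (rows p) (stated p))
         (λ p _ _ → row p)
         (λ p _ p≮ → ∑-zero A (term K 0 A p) (λ h _ → vanishes p h
           (≤-trans (m≮o∸n⇒o≤n+m p (2 * k) (2 * n + 3) p≮)
                    (≤-trans (≤-reflexive (+-comm (2 * k) p)) (m≤m+n (p + 2 * k) h)))))
         (λ p p< p≮A → ⊥-elim (p≮A (below-when-room n p (2 * k) (m<o∸n⇒m+n<o p (2 * k) (2 * n + 3) p<)
                                                   (4≤2*[2+K] K)))) ⟩
  ∑ M (λ p → ∑ (rows p) (stated p))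
    ≡⟨ ∑-cong M (λ p _ → sumBelow≡∑ (rows p) (stated p)) ⟨
  ∑ M (λ p → sumBelow (rows p) (stated p))
    ≡⟨ sumBelow≡∑ M (λ p → sumBelow (rows p) (stated p)) ⟨
  sumBelow M (λ p → sumBelow (rows p) (stated p)) ∎
  where
  open ≡-Reasoning
  k = 2 + K
  A = n + n + 0
  M = 2 * n + 3 ∸ 2 * k
  rows : ℕ → ℕ
  rows p = 2 * n + 3 ∸ (p + 2 * k)
  stated : ℕ → ℕ → ℕ
  stated p h = Pre p h * multichoose (p + 1) K * multichoose ((2 * n + 4 ∸ (h + p + 2 * k)) / 2) h
  vanishes : ∀ p h → 2 * n + 3 ≤ p + 2 * k + h → term K 0 A p h ≡ 0
  vanishes p h le = weighted-tailWays-vanish {prefixes 0 p h} (multichoose (suc p) K) h A _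
                      (inj₂ (tail-too-long n K p h le))
  row : ∀ p → ∑ A (term K 0 A p) ≡ ∑ (rows p) (stated p)
  row p = ∑-cong-support (rows p) A (term K 0 A p) (stated p)
    (λ h h< _ → term-as-stated n K p h (m<o∸n⇒m+n<o h (p + 2 * k) (2 * n + 3) h<))
    (λ h _ h≮ → vanishes p h (m≮o∸n⇒o≤n+m h (p + 2 * k) (2 * n + 3) h≮))
    (λ h h< h≮A → ⊥-elim (h≮A (below-when-room n h (p + 2 * k) (m<o∸n⇒m+n<o h (p + 2 * k) (2 * n + 3) h<)
                                               (≤-trans (4≤2*[2+K] K) (m≤n+m (2 * k) p)))))

module _ (n K : ℕ) where

  IsAvoider : List Step → Set
  IsAvoider w = (T (validFrom 0 w) × semilength w ≡ n) × ¬ pattern-H (2 + K) ⊆ w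

  isPath : (w : List Step) → Dec (T (validFrom 0 w) × semilength w ≡ n)
  isPath w = T? (validFrom 0 w) ×-dec (semilength w ≟ n)

  avoiding : (w : List Step) → Dec (IsAvoider w)
  avoiding w = isPath w ×-dec ¬? (pattern-H (2 + K) ⊆? w)

  fewH₂ : (w : List Step) → Dec (countStep H₂ w < suc K)
  fewH₂ w = countStep H₂ w <? suc K

  avoiding-with-few-H₂ :
    count (λ w → avoiding w ×-dec fewH₂ w) (wordsUpTo (2 * n)) ≡ sumBelow (suc K) (λ q → Sch n q)
  avoiding-with-few-H₂ = begin
    count (λ w → avoiding w ×-dec fewH₂ w) (wordsUpTo (2 * n))
      ≡⟨ count-cong (λ w → avoiding w ×-dec fewH₂ w) (λ w → isPath w ×-dec fewH₂ w)
                    (λ w ((p , _) , q) → p , q) (λ w (p , q) → (p , avoids-if-few-H₂ K w q) , q)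
                    (wordsUpTo (2 * n)) ⟩
    count (λ w → isPath w ×-dec fewH₂ w) (wordsUpTo (2 * n))
      ≡⟨ ∑-count-by-value isPath (countStep H₂) (suc K) (wordsUpTo (2 * n)) ⟨
    ∑ (suc K) (λ q → Sch n q)
      ≡⟨ sumBelow≡∑ (suc K) (λ q → Sch n q) ⟨
    sumBelow (suc K) (λ q → Sch n q) ∎
    where open ≡-Reasoning

  avoiding-with-many-H₂ : count (λ w → avoiding w ×-dec ¬? (fewH₂ w)) (wordsUpTo (2 * n))
                            ≡ acceptedUpTo (2 * n) (λ w → accepts w K 0 n)
  avoiding-with-many-H₂ = begin
    count many (wordsUpTo (2 * n))
      ≡⟨ count-concatMap many (wordsOfLength allSteps) (upTo (suc (2 * n))) ⟩
    sumBelow (suc (2 * n)) (λ L → count many (wordsOfLength allSteps L))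
      ≡⟨ sumBelow≡∑ (suc (2 * n)) (λ L → count many (wordsOfLength allSteps L)) ⟩
    ∑ (suc (2 * n)) (λ L → count many (wordsOfLength allSteps L))
      ≡⟨ ∑-cong (suc (2 * n)) (λ L _ →
           count-cong many (λ w → T? (accepts w K 0 n)) complete sound (wordsOfLength allSteps L)) ⟩
    acceptedUpTo (2 * n) (λ w → accepts w K 0 n) ∎
    where
    open ≡-Reasoning
    many : (w : List Step) → Dec (IsAvoider w × ¬ countStep H₂ w < suc K)
    many w = avoiding w ×-dec ¬? (fewH₂ w)
    complete : ∀ w → IsAvoider w × ¬ countStep H₂ w < suc K → T (accepts w K 0 n)
    complete w (((v , e) , a) , ≮) = accepts-complete w K 0 n v e a (≮⇒≥ ≮)
    sound : ∀ w → T (accepts w K 0 n) → IsAvoider w × ¬ countStep H₂ w < suc K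
    sound w t with accepts-sound w K 0 n t
    ... | v , e , a , enough = ((v , e) , a) , ≤⇒≯ enough

  avoiders-count : s n (pattern-H (2 + K))
    ≡ sumBelow (suc K) (λ q → Sch n q)
      + sumBelow (2 * n + 3 ∸ 2 * (2 + K)) (λ p →
          sumBelow (2 * n + 3 ∸ (p + 2 * (2 + K))) (λ h →
            Pre p h * multichoose (p + 1) K * multichoose ((2 * n + 4 ∸ (h + p + 2 * (2 + K))) / 2) h))
  avoiders-count = begin
    s n (pattern-H (2 + K))
      ≡⟨ count-split avoiding fewH₂ (wordsUpTo (2 * n)) ⟩
    count (λ w → avoiding w ×-dec fewH₂ w) (wordsUpTo (2 * n))
      + count (λ w → avoiding w ×-dec ¬? (fewH₂ w)) (wordsUpTo (2 * n))
      ≡⟨ cong₂ _+_ avoiding-with-few-H₂ avoiding-with-many-H₂ ⟩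
    sumBelow (suc K) (λ q → Sch n q) + acceptedUpTo (2 * n) (λ w → accepts w K 0 n)
      ≡⟨ cong (sumBelow (suc K) (λ q → Sch n q) +_)
              (acceptedUpTo-closedForm (2 * n) K 0 n (≤-reflexive (+-assoc n n 0))) ⟩
    sumBelow (suc K) (λ q → Sch n q) + closedForm K 0 (n + n + 0)
      ≡⟨ cong (sumBelow (suc K) (λ q → Sch n q) +_) (closedForm-as-stated n K) ⟩
    _ ∎
    where open ≡-Reasoning

mainTheorem8 : (n k : ℕ) → 1 < k →
    s n (pattern-H k)
      ≡ sumBelow (k ∸ 1) (λ q → Sch n q)
        + sumBelow (2 * n + 3 ∸ 2 * k) (λ p →
            sumBelow (2 * n + 3 ∸ (p + 2 * k)) (λ h →
              Pre p h * multichoose (p + 1) (k ∸ 2)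
                * multichoose ((2 * n + 4 ∸ (h + p + 2 * k)) / 2) h))
mainTheorem8 n (suc zero)    (s≤s ())
mainTheorem8 n (suc (suc K)) _ = avoiders-count n K
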